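{- For $r\ge 2$ and $n\ge r$, \[V_n^{(r)}(x,y)=x\sum_{i=1}^{r-1}(n-1)_{i-1}\,V_{n-i}^{(r)}(x,y)+(y+n-r)(n-1)_{r-1}\,V_{n-r}^{(r)}(x,y),\] where $V_n^{(r)}(x,y)=x^{(n)}$ for $0\le n\le r-1$.
   Context: Fix an integer $r\ge 2$ and indeterminates $x,y$. For $n\ge 1$ let $A_n^{(r)}(x,y)=(a_{i,j})_{1\le i,j\le n}$ be the $n\times n$ matrix with $a_{i,i+1}=-i$ for $1\le i\le n-1$; $a_{i,j}=x$ whenever $0\le i-j\le r-2$; $a_{i,i-r+1}=y+i-r$ for $r\le i\le n$; and all other entries $0$. Define $V_0^{(r)}(x,y)=1$ and $V_n^{(r)}(x,y)=\det A_n^{(r)}(x,y)$ for $n\ge 1$. Notation: $(m)_0=1$, $(m)_k=m(m-1)\cdots(m-k+1)$ (falling factorial); $x^{(0)}=1$, $x^{(n)}=x(x+1)\cdots(x+n-1)$ (rising factorial). -}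

module Defs where

open import Level using (Level)
open import Algebra.Bundles using (CommutativeRing)
open import Data.Nat as ℕ using (ℕ; zero; suc; _∸_; _≡ᵇ_; _≤ᵇ_)
open import Data.Bool using (Bool; true; false; if_then_else_; _∧_)
open import Data.Fin using (Fin; toℕ; punchIn)
import Data.Fin as Fin

falling : ℕ → ℕ → ℕ
falling m zero = 1
falling m (suc k) = m ℕ.* falling (m ∸ 1) k

module _ {c ℓ : Level} (R : CommutativeRing c ℓ) where
  open CommutativeRing R

  fromℕ : ℕ → Carrier
  fromℕ zero = 0#
  fromℕ (suc n) = 1# + fromℕ n

  sign : ℕ → Carrier
  sign zero = 1#
  sign (suc k) = - sign k

  sumFin : (n : ℕ) → (Fin n → Carrier) → Carrier
  sumFin zero f = 0#
  sumFin (suc n) f = f Fin.zero + sumFin n (λ j → f (Fin.suc j))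

  sum1 : ℕ → (ℕ → Carrier) → Carrier
  sum1 zero f = 0#
  sum1 (suc k) f = sum1 k f + f (suc k)

  det : (n : ℕ) → (Fin n → Fin n → Carrier) → Carrier
  det zero M = 1#
  det (suc n) M =
    sumFin (suc n) (λ j → sign (toℕ j) * (M Fin.zero j * det n (λ k l → M (Fin.suc k) (punchIn j l))))

  rising : Carrier → ℕ → Carrier
  rising x zero = 1#
  rising x (suc n) = rising x n * (x + fromℕ n)

  -- entry a_{i,j} of A_n^{(r)}(x,y), with 1-based indices i j ≥ 1
  entry : ℕ → Carrier → Carrier → ℕ → ℕ → Carrier
  entry r x y i j =
    if j ≡ᵇ suc i then - fromℕ i
    else if (j ≤ᵇ i) ∧ (i ≤ᵇ j ℕ.+ (r ∸ 2)) then x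
    else if (r ≤ᵇ i) ∧ (i ≡ᵇ j ℕ.+ (r ∸ 1)) then y + fromℕ (i ∸ r)
    else 0#

  A : ℕ → Carrier → Carrier → (n : ℕ) → Fin n → Fin n → Carrier
  A r x y n a b = entry r x y (suc (toℕ a)) (suc (toℕ b))

  -- V_n^{(r)}(x,y) = det A_n^{(r)}(x,y)  (V_0 = 1 = det of the empty matrix)
  V : ℕ → Carrier → Carrier → ℕ → Carrier
  V r x y n = det n (A r x y n)

-- The matrix A_n^(r) is the leading n × n block of one infinite lower Hessenberg matrix a (zero
-- above the superdiagonal), so V_n is its n-th leading principal minor.  Expanding along the first
-- row, which is how det is defined, writes the minor of the block starting at diagonal position s
-- through minors of blocks starting further down.  A strong induction that swaps a triangular
-- double sum turns this first-step decomposition into the last-step one,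
--   V_(L+1) = Σ_j V_j · (−a_(j,j+1)) ⋯ (−a_(L−1,L)) · a_(L,j).
-- For A^(r) the negated superdiagonal is 1, 2, 3, …, so the products are the falling factorials
-- (L)_(L−j), while the last row is x on the band L − j ≤ r − 2, y + L + 1 − r at L − j = r − 1 and 0
-- further left: this is the recurrence.  For n ≤ r − 1 only band terms occur, so V_(m+1) = x · T_m
-- with T_m = Σ_k (m)_k V_(m−k); as T_(m+1) = V_(m+1) + (m + 1) T_m, V_(m+2) = (x + m + 1) V_(m+1).

module Submission where

open import Defs
open import Level using (Level)
open import Algebra.Bundles using (CommutativeRing; Semiring)
open import Data.Nat using (ℕ; _≤_; _∸_)
open import Data.Product using (_×_; _,_)
open import Data.Nat as ℕ using (zero; suc; _<_; z≤n; s≤s)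
import Data.Nat.Properties as ℕₚ
open import Data.Nat.Induction using (<-rec)
open import Data.Fin using (Fin; zero; suc; toℕ; punchIn)
open import Data.Fin.Properties using (toℕ<n)
open import Data.Bool using (true; false)
open import Data.Bool.Properties using (∧-zeroʳ)
open import Function using (_∘_)
open import Relation.Binary.PropositionalEquality as ≡ using (_≡_; _≢_)
open import Relation.Nullary using (¬_)
open import Relation.Nullary.Decidable using (dec-true; dec-false)

falling-suc : ∀ n k → falling n (suc k) ≡ falling n k ℕ.* (n ∸ k)
falling-suc n zero    = ℕₚ.*-comm n 1
falling-suc n (suc k) = begin
  n ℕ.* falling (n ∸ 1) (suc k)              ≡⟨ ≡.cong (n ℕ.*_) (falling-suc (n ∸ 1) k) ⟩
  n ℕ.* (falling (n ∸ 1) k ℕ.* (n ∸ 1 ∸ k))  ≡⟨ ℕₚ.*-assoc n _ _ ⟨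
  n ℕ.* falling (n ∸ 1) k ℕ.* (n ∸ 1 ∸ k)    ≡⟨ ≡.cong (n ℕ.* falling (n ∸ 1) k ℕ.*_) (ℕₚ.∸-+-assoc n 1 k) ⟩
  n ℕ.* falling (n ∸ 1) k ℕ.* (n ∸ suc k)    ∎
  where open ≡.≡-Reasoning

suc-*-falling : ∀ s k → suc s ℕ.* falling (suc s ℕ.+ k) k ≡ falling (s ℕ.+ suc k) (suc k)
suc-*-falling s k = begin
  suc s ℕ.* falling (suc s ℕ.+ k) k              ≡⟨ ℕₚ.*-comm (suc s) _ ⟩
  falling (suc s ℕ.+ k) k ℕ.* suc s              ≡⟨ ≡.cong (falling (suc s ℕ.+ k) k ℕ.*_) (ℕₚ.m+n∸n≡m (suc s) k) ⟨
  falling (suc s ℕ.+ k) k ℕ.* (suc s ℕ.+ k ∸ k)  ≡⟨ falling-suc (suc s ℕ.+ k) k ⟨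
  falling (suc s ℕ.+ k) (suc k)                  ≡⟨ ≡.cong (λ n → falling n (suc k)) (ℕₚ.+-suc s k) ⟨
  falling (s ℕ.+ suc k) (suc k)                  ∎
  where open ≡.≡-Reasoning

≡ᵇ-refl : ∀ n → (n ℕ.≡ᵇ n) ≡ true
≡ᵇ-refl n = dec-true (n ℕₚ.≟ n) ≡.refl

≡ᵇ-false : ∀ {m n} → m ≢ n → (m ℕ.≡ᵇ n) ≡ false
≡ᵇ-false {m} {n} = dec-false (m ℕₚ.≟ n)

≤ᵇ-true : ∀ {m n} → m ≤ n → (m ℕ.≤ᵇ n) ≡ true
≤ᵇ-true {m} {n} = dec-true (m ℕₚ.≤? n)

≤ᵇ-false : ∀ {m n} → ¬ m ≤ n → (m ℕ.≤ᵇ n) ≡ false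
≤ᵇ-false {m} {n} = dec-false (m ℕₚ.≤? n)

module ℕSum {c ℓ : Level} (S : Semiring c ℓ) where
  open Semiring S
  open import Algebra.Properties.Semiring.Sum S
    using (sum; sum-cong-≋; sum-replicate-zero; *-distribˡ-sum; *-distribʳ-sum)
    renaming (∑-distrib-+ to sum-distrib-+)
  open import Relation.Binary.Reasoning.Setoid setoid

  -- Opaque, so that unifying ∑ n f with ∑ n g compares f with g instead of unfolding the fold.
  opaque
    ∑ : ℕ → (ℕ → Carrier) → Carrier
    ∑ n f = sum {n} (f ∘ toℕ)

    syntax ∑ n (λ k → e) = ∑[ k < n ] e

    ∑-empty : ∀ f → ∑ 0 f ≈ 0#
    ∑-empty f = refl

    ∑-suc : ∀ n f → ∑ (suc n) f ≈ f 0 + ∑[ k < n ] f (suc k)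
    ∑-suc n f = refl

    ∑-cong : ∀ n {f g : ℕ → Carrier} → (∀ k → k < n → f k ≈ g k) → ∑ n f ≈ ∑ n g
    ∑-cong n f≈g = sum-cong-≋ (λ i → f≈g (toℕ i) (toℕ<n i))

    ∑-zero : ∀ n {f : ℕ → Carrier} → (∀ k → k < n → f k ≈ 0#) → ∑ n f ≈ 0#
    ∑-zero n f≈0 = trans (∑-cong n f≈0) (sum-replicate-zero n)

    ∑-distrib-+ : ∀ n (f g : ℕ → Carrier) → ∑[ k < n ] (f k + g k) ≈ ∑ n f + ∑ n g
    ∑-distrib-+ n f g = sum-distrib-+ {n} (f ∘ toℕ) (g ∘ toℕ)

    *-distribˡ-∑ : ∀ n x (f : ℕ → Carrier) → x * ∑ n f ≈ ∑[ k < n ] (x * f k)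
    *-distribˡ-∑ n x f = *-distribˡ-sum {n} x (f ∘ toℕ)

    *-distribʳ-∑ : ∀ n x (f : ℕ → Carrier) → ∑ n f * x ≈ ∑[ k < n ] (f k * x)
    *-distribʳ-∑ n x f = *-distribʳ-sum {n} x (f ∘ toℕ)

  ∑-init-last : ∀ n (f : ℕ → Carrier) → ∑ (suc n) f ≈ ∑ n f + f n
  ∑-init-last zero    f =
    trans (∑-suc 0 f) (trans (+-comm _ _) (+-congʳ (trans (∑-empty _) (sym (∑-empty f)))))
  ∑-init-last (suc n) f = begin
    ∑ (suc (suc n)) f                        ≈⟨ ∑-suc (suc n) f ⟩
    f 0 + ∑[ k < suc n ] f (suc k)           ≈⟨ +-congˡ (∑-init-last n (f ∘ suc)) ⟩
    f 0 + (∑[ k < n ] f (suc k) + f (suc n)) ≈⟨ +-assoc _ _ _ ⟨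
    f 0 + ∑[ k < n ] f (suc k) + f (suc n)   ≈⟨ +-congʳ (∑-suc n f) ⟨
    ∑ (suc n) f + f (suc n)                  ∎

  ∑-split : ∀ {m n} (f : ℕ → Carrier) → m ≤ n → ∑ n f ≈ ∑ m f + ∑[ k < n ∸ m ] f (m ℕ.+ k)
  ∑-split f z≤n = trans (sym (+-identityˡ _)) (+-congʳ (sym (∑-empty f)))
  ∑-split {suc m} {suc n} f (s≤s m≤n) = begin
    ∑ (suc n) f                                                   ≈⟨ ∑-suc n f ⟩
    f 0 + ∑[ k < n ] f (suc k)                                    ≈⟨ +-congˡ (∑-split (f ∘ suc) m≤n) ⟩
    f 0 + (∑[ k < m ] f (suc k) + ∑[ k < n ∸ m ] f (suc m ℕ.+ k)) ≈⟨ +-assoc _ _ _ ⟨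
    f 0 + ∑[ k < m ] f (suc k) + ∑[ k < n ∸ m ] f (suc m ℕ.+ k)   ≈⟨ +-congʳ (∑-suc m f) ⟨
    ∑ (suc m) f + ∑[ k < n ∸ m ] f (suc m ℕ.+ k)                  ∎

  ∑-reverse : ∀ n (f : ℕ → Carrier) → ∑ n f ≈ ∑[ k < n ] f (n ∸ suc k)
  ∑-reverse zero    f = trans (∑-empty f) (sym (∑-empty _))
  ∑-reverse (suc n) f = begin
    ∑ (suc n) f                     ≈⟨ ∑-init-last n f ⟩
    ∑ n f + f n                     ≈⟨ +-congʳ (∑-reverse n f) ⟩
    ∑[ k < n ] f (n ∸ suc k) + f n  ≈⟨ +-comm _ _ ⟩
    f n + ∑[ k < n ] f (n ∸ suc k)  ≈⟨ ∑-suc n (λ k → f (n ∸ k)) ⟨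
    ∑[ k < suc n ] f (n ∸ k)        ∎

  ∑-triangle : ∀ n (g : ℕ → ℕ → Carrier) →
               ∑[ k < n ] ∑ (n ∸ k) (g k) ≈ ∑[ t < n ] ∑[ k < suc t ] g k (t ∸ k)
  ∑-triangle zero    g = trans (∑-empty _) (sym (∑-empty _))
  ∑-triangle (suc n) g = begin
    ∑[ k < suc n ] ∑ (suc n ∸ k) (g k)
      ≈⟨ ∑-suc n _ ⟩
    ∑ (suc n) (g 0) + ∑[ k < n ] ∑ (n ∸ k) (g (suc k))
      ≈⟨ +-congˡ (∑-triangle n (g ∘ suc)) ⟩
    ∑ (suc n) (g 0) + ∑[ t < n ] ∑[ k < suc t ] g (suc k) (t ∸ k)
      ≈⟨ +-congˡ (trans (sym (+-identityˡ _)) (+-congʳ (sym (∑-empty _)))) ⟩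
    ∑ (suc n) (g 0) + (∑[ k < 0 ] g (suc k) (0 ∸ suc k) + ∑[ t < n ] ∑[ k < suc t ] g (suc k) (t ∸ k))
      ≈⟨ +-congˡ (∑-suc n (λ t → ∑[ k < t ] g (suc k) (t ∸ suc k))) ⟨
    ∑ (suc n) (g 0) + ∑[ t < suc n ] ∑[ k < t ] g (suc k) (t ∸ suc k)
      ≈⟨ ∑-distrib-+ (suc n) (g 0) (λ t → ∑[ k < t ] g (suc k) (t ∸ suc k)) ⟨
    ∑[ t < suc n ] (g 0 t + ∑[ k < t ] g (suc k) (t ∸ suc k))
      ≈⟨ ∑-cong (suc n) (λ t _ → sym (∑-suc t (λ k → g k (t ∸ k)))) ⟩
    ∑[ t < suc n ] ∑[ k < suc t ] g k (t ∸ k) ∎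

module Renewal {c ℓ : Level} (S : Semiring c ℓ) where
  open Semiring S
  open ℕSum S
  open import Relation.Binary.Reasoning.Setoid setoid

  module _ (D W : ℕ → ℕ → Carrier)
           (D-zero : ∀ s → D s 0 ≈ 1#)
           (firstStep : ∀ s L → D s (suc L) ≈ ∑[ k < suc L ] (W s k * D (s ℕ.+ suc k) (L ∸ k)))
           where

    threeStep : ℕ → ℕ → ℕ → ℕ → Carrier
    threeStep s L k j = W s k * (D (s ℕ.+ suc k) j * W (s ℕ.+ suc k ℕ.+ j) (L ∸ suc k ∸ j))

    ∑-threeStep-antidiagonal : ∀ s L t →
      ∑[ k < suc t ] threeStep s L k (t ∸ k) ≈ D s (suc t) * W (s ℕ.+ suc t) (L ∸ suc t)
    ∑-threeStep-antidiagonal s L t = begin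
      ∑[ k < suc t ] threeStep s L k (t ∸ k)
        ≈⟨ ∑-cong (suc t) reassoc ⟩
      ∑[ k < suc t ] (W s k * D (s ℕ.+ suc k) (t ∸ k) * W (s ℕ.+ suc t) (L ∸ suc t))
        ≈⟨ *-distribʳ-∑ (suc t) _ _ ⟨
      ∑[ k < suc t ] (W s k * D (s ℕ.+ suc k) (t ∸ k)) * W (s ℕ.+ suc t) (L ∸ suc t)
        ≈⟨ *-congʳ (firstStep s t) ⟨
      D s (suc t) * W (s ℕ.+ suc t) (L ∸ suc t) ∎
      where
      reassoc : ∀ k → k < suc t →
                threeStep s L k (t ∸ k) ≈ W s k * D (s ℕ.+ suc k) (t ∸ k) * W (s ℕ.+ suc t) (L ∸ suc t)
      reassoc k (s≤s k≤t) = trans (sym (*-assoc _ _ _)) (*-congˡ (reflexive (≡.cong₂ W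
        (≡.trans (ℕₚ.+-assoc s (suc k) (t ∸ k)) (≡.cong (s ℕ.+_) k+[t∸k]≡t))
        (≡.trans (ℕₚ.∸-+-assoc L (suc k) (t ∸ k)) (≡.cong (L ∸_) k+[t∸k]≡t)))))
        where
        k+[t∸k]≡t : suc k ℕ.+ (t ∸ k) ≡ suc t
        k+[t∸k]≡t = ≡.cong suc (ℕₚ.m+[n∸m]≡n k≤t)

    lastSingleStep : ∀ s L → W s L * D (s ℕ.+ suc L) (L ∸ L) ≈ D s 0 * W (s ℕ.+ 0) L
    lastSingleStep s L = begin
      W s L * D (s ℕ.+ suc L) (L ∸ L)  ≡⟨ ≡.cong (λ m → W s L * D (s ℕ.+ suc L) m) (ℕₚ.n∸n≡0 L) ⟩
      W s L * D (s ℕ.+ suc L) 0        ≈⟨ trans (*-congˡ (D-zero _)) (*-identityʳ _) ⟩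
      W s L                            ≡⟨ ≡.cong (λ m → W m L) (ℕₚ.+-identityʳ s) ⟨
      W (s ℕ.+ 0) L                    ≈⟨ trans (*-congʳ (D-zero s)) (*-identityˡ _) ⟨
      D s 0 * W (s ℕ.+ 0) L            ∎

    LastStep : ℕ → Set ℓ
    LastStep L = ∀ s → D s (suc L) ≈ ∑[ j < suc L ] (D s j * W (s ℕ.+ j) (L ∸ j))

    lastStep : ∀ L → LastStep L
    lastStep = <-rec LastStep step
      where
      step : ∀ L → (∀ {M} → M < L → LastStep M) → LastStep L
      step L rec s = begin
        D s (suc L)
          ≈⟨ firstStep s L ⟩
        ∑[ k < suc L ] (W s k * D (s ℕ.+ suc k) (L ∸ k))
          ≈⟨ ∑-init-last L _ ⟩
        ∑[ k < L ] (W s k * D (s ℕ.+ suc k) (L ∸ k)) + W s L * D (s ℕ.+ suc L) (L ∸ L)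
          ≈⟨ +-cong (∑-cong L expand) (lastSingleStep s L) ⟩
        ∑[ k < L ] ∑ (L ∸ k) (threeStep s L k) + D s 0 * W (s ℕ.+ 0) L
          ≈⟨ +-congʳ (∑-triangle L (threeStep s L)) ⟩
        ∑[ t < L ] ∑[ k < suc t ] threeStep s L k (t ∸ k) + D s 0 * W (s ℕ.+ 0) L
          ≈⟨ +-congʳ (∑-cong L (λ t _ → ∑-threeStep-antidiagonal s L t)) ⟩
        ∑[ t < L ] (D s (suc t) * W (s ℕ.+ suc t) (L ∸ suc t)) + D s 0 * W (s ℕ.+ 0) L
          ≈⟨ +-comm _ _ ⟩
        D s 0 * W (s ℕ.+ 0) L + ∑[ t < L ] (D s (suc t) * W (s ℕ.+ suc t) (L ∸ suc t))
          ≈⟨ ∑-suc L _ ⟨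
        ∑[ j < suc L ] (D s j * W (s ℕ.+ j) (L ∸ j)) ∎
        where
        expand : ∀ k → k < L → W s k * D (s ℕ.+ suc k) (L ∸ k) ≈ ∑ (L ∸ k) (threeStep s L k)
        expand k k<L = begin
          W s k * D (s ℕ.+ suc k) (L ∸ k)  ≡⟨ ≡.cong (λ m → W s k * D (s ℕ.+ suc k) m) L∸k≡1+M ⟩
          W s k * D (s ℕ.+ suc k) (suc M)  ≈⟨ *-congˡ (rec (ℕₚ.∸-monoʳ-< ℕ.z<s k<L) (s ℕ.+ suc k)) ⟩
          W s k * ∑[ j < suc M ] (D (s ℕ.+ suc k) j * W (s ℕ.+ suc k ℕ.+ j) (M ∸ j))
                                           ≈⟨ *-distribˡ-∑ (suc M) (W s k) _ ⟩
          ∑ (suc M) (threeStep s L k)      ≡⟨ ≡.cong (λ m → ∑ m (threeStep s L k)) L∸k≡1+M ⟨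
          ∑ (L ∸ k) (threeStep s L k)      ∎
          where
          M = L ∸ suc k
          L∸k≡1+M : L ∸ k ≡ suc M
          L∸k≡1+M = ℕₚ.+-∸-assoc 1 k<L

module Properties {c ℓ : Level} (R : CommutativeRing c ℓ) where
  open CommutativeRing R hiding (zero)
  open ℕSum semiring
  open import Algebra.Properties.Ring ring using (-1*x≈-x; -‿distribˡ-*)
  open import Algebra.Properties.Semiring.Mult semiring using (×1-homo-*) renaming (_×_ to _×ᴿ_)

  fromℕ≡×1 : ∀ n → fromℕ R n ≡ n ×ᴿ 1#
  fromℕ≡×1 zero    = ≡.refl
  fromℕ≡×1 (suc n) = ≡.cong (1# +_) (fromℕ≡×1 n)

  fromℕ-* : ∀ m n → fromℕ R (m ℕ.* n) ≈ fromℕ R m * fromℕ R n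
  fromℕ-* m n rewrite fromℕ≡×1 (m ℕ.* n) | fromℕ≡×1 m | fromℕ≡×1 n = ×1-homo-* m n

  sum1≈∑ : ∀ m (g : ℕ → Carrier) → sum1 R m g ≈ ∑[ k < m ] g (suc k)
  sum1≈∑ zero    g = sym (∑-empty _)
  sum1≈∑ (suc m) g = trans (+-congʳ (sum1≈∑ m g)) (sym (∑-init-last m (g ∘ suc)))

  sumFin-cong : ∀ n {f g : Fin n → Carrier} → (∀ j → f j ≈ g j) → sumFin R n f ≈ sumFin R n g
  sumFin-cong zero    f≈g = refl
  sumFin-cong (suc n) f≈g = +-cong (f≈g zero) (sumFin-cong n (f≈g ∘ suc))

  sumFin-zero : ∀ n {f : Fin n → Carrier} → (∀ j → f j ≈ 0#) → sumFin R n f ≈ 0#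
  sumFin-zero zero    f≈0 = refl
  sumFin-zero (suc n) f≈0 = trans (+-cong (f≈0 zero) (sumFin-zero n (f≈0 ∘ suc))) (+-identityʳ 0#)

  det-cong : ∀ n {M N : Fin n → Fin n → Carrier} → (∀ a b → M a b ≈ N a b) → det R n M ≈ det R n N
  det-cong zero    M≈N = refl
  det-cong (suc n) M≈N = sumFin-cong (suc n) λ j →
    *-cong (refl {sign R (toℕ j)}) (*-cong (M≈N zero j) (det-cong n (λ k l → M≈N (suc k) (punchIn j l))))

  minor : ∀ {n} → (Fin (suc n) → Fin (suc n) → Carrier) → Fin (suc n) → Fin n → Fin n → Carrier
  minor M j k l = M (suc k) (punchIn j l)

  det-firstRowTwoTerms : ∀ n (M : Fin (suc (suc n)) → Fin (suc (suc n)) → Carrier) →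
    (∀ j → M zero (suc (suc j)) ≈ 0#) →
    det R (suc (suc n)) M ≈
      M zero zero * det R (suc n) (minor M zero) + - M zero (suc zero) * det R (suc n) (minor M (suc zero))
  det-firstRowTwoTerms n M row≈0 =
    +-cong (*-identityˡ _)
           (trans (+-cong (trans (-1*x≈-x _) (-‿distribˡ-* _ _))
                          (sumFin-zero n λ j → trans (*-congˡ (trans (*-congʳ (row≈0 j)) (zeroˡ _))) (zeroʳ _)))
                  (+-identityʳ _))

module Hessenberg {c ℓ : Level} (R : CommutativeRing c ℓ) where
  open CommutativeRing R hiding (zero)
  open ℕSum semiring
  open Properties R
  open import Relation.Binary.Reasoning.Setoid setoid

  Matrix : Set c
  Matrix = ℕ → ℕ → Carrier

  leadingMinor : Matrix → ℕ → Carrier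
  leadingMinor h n = det R n (λ a b → h (toℕ a) (toℕ b))

  shift : ℕ → Matrix → Matrix
  shift s h i j = h (s ℕ.+ i) (s ℕ.+ j)

  -- Deleting row 0 and column 1 of a Hessenberg leading minor leaves column 0 in front of the
  -- shifted matrix; allowing an arbitrary first column makes the first-row expansion an induction.
  withColumn₀ : (ℕ → Carrier) → Matrix → Matrix
  withColumn₀ v h i zero    = v i
  withColumn₀ v h i (suc j) = h i (suc j)

  IsLowerHessenberg : Matrix → Set ℓ
  IsLowerHessenberg h = ∀ {i j} → suc i < j → h i j ≈ 0#

  shift-isLowerHessenberg : ∀ s {h} → IsLowerHessenberg h → IsLowerHessenberg (shift s h)
  shift-isLowerHessenberg s hess {i} {j} i+1<j =
    hess (≡.subst (_< s ℕ.+ j) (ℕₚ.+-suc s i) (ℕₚ.+-monoʳ-< s i+1<j))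

  negSuperdiagonalProduct : Matrix → ℕ → Carrier
  negSuperdiagonalProduct h zero    = 1#
  negSuperdiagonalProduct h (suc k) = - h 0 1 * negSuperdiagonalProduct (shift 1 h) k

  hookWeight : Matrix → ℕ → Carrier
  hookWeight h k = negSuperdiagonalProduct h k * h k 0

  leadingMinor-shift-shift : ∀ a b h n → leadingMinor (shift a (shift b h)) n ≈ leadingMinor (shift (b ℕ.+ a) h) n
  leadingMinor-shift-shift a b h n = det-cong n λ i j →
    reflexive (≡.cong₂ h (≡.sym (ℕₚ.+-assoc b a (toℕ i))) (≡.sym (ℕₚ.+-assoc b a (toℕ j))))

  withColumn₀-step : ∀ {h} → IsLowerHessenberg h → ∀ L v →
    leadingMinor (withColumn₀ v h) (suc (suc L)) ≈
      v 0 * leadingMinor (shift 1 h) (suc L) + - h 0 1 * leadingMinor (withColumn₀ (v ∘ suc) (shift 1 h)) (suc L)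
  withColumn₀-step {h} hess L v =
    trans (det-firstRowTwoTerms L (λ a b → withColumn₀ v h (toℕ a) (toℕ b)) (λ _ → hess (s≤s (s≤s z≤n))))
          (+-congˡ (*-congˡ (det-cong (suc L) minor₁)))
    where
    minor₁ : ∀ k l → withColumn₀ v h (suc (toℕ k)) (toℕ (punchIn (suc zero) l))
                   ≈ withColumn₀ (v ∘ suc) (shift 1 h) (toℕ k) (toℕ l)
    minor₁ k zero    = refl
    minor₁ k (suc l) = refl

  withColumn₀-expansion : ∀ L {h} → IsLowerHessenberg h → ∀ v →
    leadingMinor (withColumn₀ v h) (suc L) ≈
      ∑[ k < suc L ] (negSuperdiagonalProduct h k * v k * leadingMinor (shift (suc k) h) (L ∸ k))
  withColumn₀-expansion zero    hess v =
    trans (+-congʳ (sym (*-assoc _ _ _))) (sym (trans (∑-suc 0 _) (+-congˡ (∑-empty _))))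
  withColumn₀-expansion (suc L) {h} hess v = begin
    leadingMinor (withColumn₀ v h) (suc (suc L))
      ≈⟨ withColumn₀-step hess L v ⟩
    v 0 * leadingMinor (shift 1 h) (suc L) + - h 0 1 * leadingMinor (withColumn₀ (v ∘ suc) (shift 1 h)) (suc L)
      ≈⟨ +-cong (*-congʳ (sym (*-identityˡ (v 0))))
                (*-congˡ (withColumn₀-expansion L (shift-isLowerHessenberg 1 hess) (v ∘ suc))) ⟩
    1# * v 0 * leadingMinor (shift 1 h) (suc L) + - h 0 1 * ∑[ k < suc L ] term k
      ≈⟨ +-congˡ (trans (*-distribˡ-∑ (suc L) (- h 0 1) term) (∑-cong (suc L) λ _ _ → reassoc _ _ _ _)) ⟩
    1# * v 0 * leadingMinor (shift 1 h) (suc L) +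
      ∑[ k < suc L ] (negSuperdiagonalProduct h (suc k) * v (suc k) * leadingMinor (shift (suc (suc k)) h) (L ∸ k))
      ≈⟨ ∑-suc (suc L) _ ⟨
    ∑[ k < suc (suc L) ] (negSuperdiagonalProduct h k * v k * leadingMinor (shift (suc k) h) (suc L ∸ k)) ∎
    where
    term : ℕ → Carrier
    term k = negSuperdiagonalProduct (shift 1 h) k * v (suc k) * leadingMinor (shift (suc k) (shift 1 h)) (L ∸ k)
    reassoc : ∀ a p w d → a * (p * w * d) ≈ a * p * w * d
    reassoc a p w d = trans (sym (*-assoc a (p * w) d)) (*-congʳ (sym (*-assoc a p w)))

  firstRowExpansion : ∀ {h} → IsLowerHessenberg h → ∀ L →
    leadingMinor h (suc L) ≈ ∑[ k < suc L ] (hookWeight h k * leadingMinor (shift (suc k) h) (L ∸ k))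
  firstRowExpansion {h} hess L = trans (det-cong (suc L) column₀) (withColumn₀-expansion L hess (λ i → h i 0))
    where
    column₀ : ∀ a b → h (toℕ a) (toℕ b) ≈ withColumn₀ (λ i → h i 0) h (toℕ a) (toℕ b)
    column₀ a zero    = refl
    column₀ a (suc b) = refl

  lastRowExpansion : ∀ {h} → IsLowerHessenberg h → ∀ L →
    leadingMinor h (suc L) ≈ ∑[ j < suc L ] (leadingMinor h j * hookWeight (shift j h) (L ∸ j))
  lastRowExpansion {h} hess L =
    Renewal.lastStep semiring (λ s → leadingMinor (shift s h)) (λ s → hookWeight (shift s h)) (λ _ → refl)
                     firstStep L 0
    where
    firstStep : ∀ s L → leadingMinor (shift s h) (suc L) ≈
                  ∑[ k < suc L ] (hookWeight (shift s h) k * leadingMinor (shift (s ℕ.+ suc k) h) (L ∸ k))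
    firstStep s L = trans (firstRowExpansion (shift-isLowerHessenberg s hess) L)
                          (∑-cong (suc L) λ k _ → *-congˡ (leadingMinor-shift-shift (suc k) s h (L ∸ k)))

  negSuperdiagonalProduct≈falling : ∀ k s {h} → (∀ i → - h i (suc i) ≈ fromℕ R (suc (s ℕ.+ i))) →
                                    negSuperdiagonalProduct h k ≈ fromℕ R (falling (s ℕ.+ k) k)
  negSuperdiagonalProduct≈falling zero    s super = sym (+-identityʳ 1#)
  negSuperdiagonalProduct≈falling (suc k) s {h} super = begin
    - h 0 1 * negSuperdiagonalProduct (shift 1 h) k
      ≈⟨ *-cong (trans (super 0) (reflexive (≡.cong (fromℕ R ∘ suc) (ℕₚ.+-identityʳ s))))
                (negSuperdiagonalProduct≈falling k (suc s) super₁) ⟩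
    fromℕ R (suc s) * fromℕ R (falling (suc s ℕ.+ k) k)  ≈⟨ fromℕ-* (suc s) (falling (suc s ℕ.+ k) k) ⟨
    fromℕ R (suc s ℕ.* falling (suc s ℕ.+ k) k)          ≡⟨ ≡.cong (fromℕ R) (suc-*-falling s k) ⟩
    fromℕ R (falling (s ℕ.+ suc k) (suc k))              ∎
    where
    super₁ : ∀ i → - h (suc i) (suc (suc i)) ≈ fromℕ R (suc (suc s ℕ.+ i))
    super₁ i = trans (super (suc i)) (reflexive (≡.cong (fromℕ R ∘ suc) (ℕₚ.+-suc s i)))

-- r = q + 2, so that r ∸ 1 and r ∸ 2 reduce; a i j is the paper's a_(i+1,j+1).
module Recurrence {c ℓ : Level} (R : CommutativeRing c ℓ) (q : ℕ) (x y : CommutativeRing.Carrier R) where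
  open CommutativeRing R hiding (zero)
  open ℕSum semiring
  open Properties R
  open Hessenberg R
  open import Algebra.Properties.Ring ring using (-‿involutive)
  open import Algebra.Properties.CommutativeSemigroup *-commutativeSemigroup using (x∙yz≈y∙xz; x∙yz≈z∙yx)
  open import Relation.Binary.Reasoning.Setoid setoid

  a : Matrix
  a i j = entry R (suc (suc q)) x y (suc i) (suc j)

  v : ℕ → Carrier
  v = V R (suc (suc q)) x y

  a-superdiagonal : ∀ i → a i (suc i) ≡ - fromℕ R (suc i)
  a-superdiagonal i rewrite ≡ᵇ-refl i = ≡.refl

  a-isLowerHessenberg : IsLowerHessenberg a
  a-isLowerHessenberg {i} {j} i+1<j
    rewrite ≡ᵇ-false (ℕₚ.>⇒≢ i+1<j)
          | ≤ᵇ-false (ℕₚ.<⇒≱ (s≤s (ℕₚ.<⇒≤ i+1<j)))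
          | ≡ᵇ-false {suc i} {suc j ℕ.+ suc q}
                     (ℕₚ.<⇒≢ (s≤s (ℕₚ.<-≤-trans (ℕₚ.<⇒≤ i+1<j) (ℕₚ.m≤m+n j (suc q)))))
          | ∧-zeroʳ (suc (suc q) ℕ.≤ᵇ suc i) = refl

  a-band : ∀ j {d} → d ≤ q → a (j ℕ.+ d) j ≡ x
  a-band j {d} d≤q
    rewrite ≡ᵇ-false {suc j} {suc (suc (j ℕ.+ d))} (ℕₚ.<⇒≢ (s≤s (s≤s (ℕₚ.m≤m+n j d))))
          | ≤ᵇ-true (s≤s (ℕₚ.m≤m+n j d))
          | ≤ᵇ-true (s≤s (ℕₚ.+-monoʳ-≤ j d≤q)) = ≡.refl

  a-corner : ∀ j → a (j ℕ.+ suc q) j ≡ y + fromℕ R j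
  a-corner j
    rewrite ≡ᵇ-false {suc j} {suc (suc (j ℕ.+ suc q))} (ℕₚ.<⇒≢ (s≤s (s≤s (ℕₚ.m≤m+n j (suc q)))))
          | ≤ᵇ-true (s≤s (ℕₚ.m≤m+n j (suc q)))
          | ≤ᵇ-false (ℕₚ.<⇒≱ (s≤s (ℕₚ.+-monoʳ-< j (ℕₚ.n<1+n q))))
          | ≤ᵇ-true (s≤s (ℕₚ.m≤n+m (suc q) j))
          | ≡ᵇ-refl (j ℕ.+ suc q)
          | ℕₚ.m+n∸n≡m j (suc q) = ≡.refl

  a-below : ∀ j {d} → suc q < d → a (j ℕ.+ d) j ≡ 0#
  a-below j {d} q<d
    rewrite ≡ᵇ-false {suc j} {suc (suc (j ℕ.+ d))} (ℕₚ.<⇒≢ (s≤s (s≤s (ℕₚ.m≤m+n j d))))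
          | ≤ᵇ-true (s≤s (ℕₚ.m≤m+n j d))
          | ≤ᵇ-false (ℕₚ.<⇒≱ (s≤s (ℕₚ.<-trans (ℕₚ.+-monoʳ-< j (ℕₚ.n<1+n q)) (ℕₚ.+-monoʳ-< j q<d))))
          | ≡ᵇ-false (ℕₚ.>⇒≢ (s≤s (ℕₚ.+-monoʳ-< j q<d)))
          | ∧-zeroʳ (suc (suc q) ℕ.≤ᵇ suc (j ℕ.+ d)) = ≡.refl

  a-onSubdiagonal : ∀ {k L} → k ≤ L → a L (L ∸ k) ≡ a (L ∸ k ℕ.+ k) (L ∸ k)
  a-onSubdiagonal {k} {L} k≤L = ≡.cong (λ i → a i (L ∸ k)) (≡.sym (ℕₚ.m∸n+n≡m k≤L))

  shift-a-superdiagonal : ∀ s i → - shift s a i (suc i) ≈ fromℕ R (suc (s ℕ.+ i))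
  shift-a-superdiagonal s i = begin
    - a (s ℕ.+ i) (s ℕ.+ suc i)   ≡⟨ ≡.cong (λ j → - a (s ℕ.+ i) j) (ℕₚ.+-suc s i) ⟩
    - a (s ℕ.+ i) (suc (s ℕ.+ i)) ≡⟨ ≡.cong -_ (a-superdiagonal (s ℕ.+ i)) ⟩
    - - fromℕ R (suc (s ℕ.+ i))   ≈⟨ -‿involutive _ ⟩
    fromℕ R (suc (s ℕ.+ i))       ∎

  hookWeight-shift-a : ∀ {k L} → k ≤ L →
    hookWeight (shift (L ∸ k) a) (L ∸ (L ∸ k)) ≈ fromℕ R (falling L k) * a L (L ∸ k)
  hookWeight-shift-a {k} {L} k≤L = begin
    hookWeight (shift (L ∸ k) a) (L ∸ (L ∸ k))
      ≡⟨ ≡.cong (hookWeight (shift (L ∸ k) a)) (ℕₚ.m∸[m∸n]≡n k≤L) ⟩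
    negSuperdiagonalProduct (shift (L ∸ k) a) k * a (L ∸ k ℕ.+ k) (L ∸ k ℕ.+ 0)
      ≈⟨ *-cong (negSuperdiagonalProduct≈falling k (L ∸ k) (shift-a-superdiagonal (L ∸ k)))
                (reflexive (≡.cong₂ a (ℕₚ.m∸n+n≡m k≤L) (ℕₚ.+-identityʳ (L ∸ k)))) ⟩
    fromℕ R (falling (L ∸ k ℕ.+ k) k) * a L (L ∸ k)
      ≡⟨ ≡.cong (λ n → fromℕ R (falling n k) * a L (L ∸ k)) (ℕₚ.m∸n+n≡m k≤L) ⟩
    fromℕ R (falling L k) * a L (L ∸ k) ∎

  v-expansion : ∀ L → v (suc L) ≈ ∑[ k < suc L ] (a L (L ∸ k) * (fromℕ R (falling L k) * v (L ∸ k)))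
  v-expansion L = begin
    v (suc L)
      ≈⟨ lastRowExpansion a-isLowerHessenberg L ⟩
    ∑[ j < suc L ] (v j * hookWeight (shift j a) (L ∸ j))
      ≈⟨ ∑-reverse (suc L) _ ⟩
    ∑[ k < suc L ] (v (L ∸ k) * hookWeight (shift (L ∸ k) a) (L ∸ (L ∸ k)))
      ≈⟨ ∑-cong (suc L) term ⟩
    ∑[ k < suc L ] (a L (L ∸ k) * (fromℕ R (falling L k) * v (L ∸ k))) ∎
    where
    term : ∀ k → k < suc L → v (L ∸ k) * hookWeight (shift (L ∸ k) a) (L ∸ (L ∸ k)) ≈
                             a L (L ∸ k) * (fromℕ R (falling L k) * v (L ∸ k))
    term k (s≤s k≤L) = trans (*-congˡ (hookWeight-shift-a k≤L)) (x∙yz≈z∙yx _ _ _)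

  ∑-band : ∀ {N L} → N ≤ suc q → N ≤ suc L →
    ∑[ k < N ] (a L (L ∸ k) * (fromℕ R (falling L k) * v (L ∸ k))) ≈
      x * ∑[ k < N ] (fromℕ R (falling L k) * v (L ∸ k))
  ∑-band {N} {L} N≤1+q N≤1+L = trans (∑-cong N entry≈x) (sym (*-distribˡ-∑ N x _))
    where
    entry≈x : ∀ k → k < N →
              a L (L ∸ k) * (fromℕ R (falling L k) * v (L ∸ k)) ≈ x * (fromℕ R (falling L k) * v (L ∸ k))
    entry≈x k k<N = *-congʳ (reflexive (≡.trans (a-onSubdiagonal (ℕₚ.≤-pred (ℕₚ.<-≤-trans k<N N≤1+L)))
                                                (a-band (L ∸ k) (ℕₚ.≤-pred (ℕₚ.<-≤-trans k<N N≤1+q)))))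

  v-recurrence : ∀ {L} → suc q ≤ L →
    v (suc L) ≈ x * sum1 R (suc q) (λ i → fromℕ R (falling L (i ∸ 1)) * v (suc L ∸ i))
                + (y + fromℕ R (L ∸ suc q)) * fromℕ R (falling L (suc q)) * v (L ∸ suc q)
  v-recurrence {L} q<L = begin
    v (suc L)                                                          ≈⟨ v-expansion L ⟩
    ∑[ k < suc L ] term k                                              ≈⟨ ∑-split term (s≤s q<L) ⟩
    ∑[ k < suc (suc q) ] term k + ∑[ k < L ∸ suc q ] term (suc (suc q) ℕ.+ k)
      ≈⟨ +-cong (∑-init-last (suc q) term) (∑-zero (L ∸ suc q) beyondCorner) ⟩
    ∑[ k < suc q ] term k + term (suc q) + 0#                          ≈⟨ +-identityʳ _ ⟩
    ∑[ k < suc q ] term k + term (suc q)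
      ≈⟨ +-cong (trans (∑-band ℕₚ.≤-refl (ℕₚ.m≤n⇒m≤1+n q<L)) (*-congˡ (sym (sum1≈∑ (suc q) _)))) corner ⟩
    x * sum1 R (suc q) (λ i → fromℕ R (falling L (i ∸ 1)) * v (suc L ∸ i))
      + (y + fromℕ R (L ∸ suc q)) * fromℕ R (falling L (suc q)) * v (L ∸ suc q) ∎
    where
    term : ℕ → Carrier
    term k = a L (L ∸ k) * (fromℕ R (falling L k) * v (L ∸ k))

    corner : term (suc q) ≈ (y + fromℕ R (L ∸ suc q)) * fromℕ R (falling L (suc q)) * v (L ∸ suc q)
    corner = trans (*-congʳ (reflexive (≡.trans (a-onSubdiagonal q<L) (a-corner (L ∸ suc q)))))
                   (sym (*-assoc _ _ _))

    beyondCorner : ∀ k → k < L ∸ suc q → term (suc (suc q) ℕ.+ k) ≈ 0#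
    beyondCorner k k<L∸q = trans (*-congʳ (reflexive (≡.trans (a-onSubdiagonal d≤L) (a-below (L ∸ d) q<d))))
                                 (zeroˡ _)
      where
      d = suc (suc q) ℕ.+ k
      q<d : suc q < d
      q<d = s≤s (s≤s (ℕₚ.m≤m+n q k))
      d≤L : d ≤ L
      d≤L = ℕₚ.≤-trans (ℕₚ.+-monoʳ-< (suc q) k<L∸q) (ℕₚ.≤-reflexive (ℕₚ.m+[n∸m]≡n q<L))

  fallingSum : ℕ → Carrier
  fallingSum m = ∑[ k < suc m ] (fromℕ R (falling m k) * v (m ∸ k))

  v-suc≈x*fallingSum : ∀ {m} → m ≤ q → v (suc m) ≈ x * fallingSum m
  v-suc≈x*fallingSum {m} m≤q = trans (v-expansion m) (∑-band (s≤s m≤q) ℕₚ.≤-refl)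

  fallingSum-suc : ∀ m → fallingSum (suc m) ≈ v (suc m) + fromℕ R (suc m) * fallingSum m
  fallingSum-suc m = begin
    fallingSum (suc m)
      ≈⟨ ∑-suc (suc m) _ ⟩
    fromℕ R 1 * v (suc m) + ∑[ k < suc m ] (fromℕ R (suc m ℕ.* falling m k) * v (m ∸ k))
      ≈⟨ +-cong (trans (*-congʳ (+-identityʳ 1#)) (*-identityˡ _))
                (∑-cong (suc m) λ k _ → trans (*-congʳ (fromℕ-* (suc m) (falling m k))) (*-assoc _ _ _)) ⟩
    v (suc m) + ∑[ k < suc m ] (fromℕ R (suc m) * (fromℕ R (falling m k) * v (m ∸ k)))
      ≈⟨ +-congˡ (*-distribˡ-∑ (suc m) _ _) ⟨
    v (suc m) + fromℕ R (suc m) * fallingSum m ∎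

  v-suc : ∀ m → m ≤ q → v (suc m) ≈ v m * (x + fromℕ R m)
  v-suc zero    _ = trans (+-identityʳ _) (*-congˡ (trans (*-identityʳ x) (sym (+-identityʳ x))))
  v-suc (suc m) m<q = begin
    v (suc (suc m))                                       ≈⟨ v-suc≈x*fallingSum m<q ⟩
    x * fallingSum (suc m)                                ≈⟨ *-congˡ (fallingSum-suc m) ⟩
    x * (v (suc m) + fromℕ R (suc m) * fallingSum m)      ≈⟨ distribˡ _ _ _ ⟩
    x * v (suc m) + x * (fromℕ R (suc m) * fallingSum m)  ≈⟨ +-congˡ (x∙yz≈y∙xz _ _ _) ⟩
    x * v (suc m) + fromℕ R (suc m) * (x * fallingSum m)  ≈⟨ +-congˡ (*-congˡ (v-suc≈x*fallingSum (ℕₚ.<⇒≤ m<q))) ⟨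
    x * v (suc m) + fromℕ R (suc m) * v (suc m)           ≈⟨ distribʳ _ _ _ ⟨
    (x + fromℕ R (suc m)) * v (suc m)                     ≈⟨ *-comm _ _ ⟩
    v (suc m) * (x + fromℕ R (suc m))                     ∎

  v-rising : ∀ n → n ≤ suc q → v n ≈ rising R x n
  v-rising zero    _         = refl
  v-rising (suc m) (s≤s m≤q) = trans (v-suc m m≤q) (*-congʳ (v-rising m (ℕₚ.m≤n⇒m≤1+n m≤q)))

theorem2p2 : {c ℓ : Level} (R : CommutativeRing c ℓ) (r : ℕ) (x y : CommutativeRing.Carrier R) →
    2 ≤ r →
    ((n : ℕ) → r ≤ n →
      CommutativeRing._≈_ R (V R r x y n)
        (CommutativeRing._+_ R
          (CommutativeRing._*_ R x
            (sum1 R (r ∸ 1) (λ i → CommutativeRing._*_ R (fromℕ R (falling (n ∸ 1) (i ∸ 1))) (V R r x y (n ∸ i)))))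
          (CommutativeRing._*_ R
            (CommutativeRing._*_ R (CommutativeRing._+_ R y (fromℕ R (n ∸ r))) (fromℕ R (falling (n ∸ 1) (r ∸ 1))))
            (V R r x y (n ∸ r)))))
    × ((n : ℕ) → n ≤ r ∸ 1 → CommutativeRing._≈_ R (V R r x y n) (rising R x n))
theorem2p2 R (suc (suc q)) x y _ = (λ { (suc L) (s≤s q<L) → v-recurrence q<L }) , v-rising
  where open Recurrence R q x y
theorem2p2 R (suc zero) x y (s≤s ())
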